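{- Let $n\ge 1$. Then $\alpha_n(\pi_n)=\pi_n$. Moreover, let $\sigma\in D_n$ with $\sigma\ne\pi_n$, and let $j$ be the smallest integer with $1\le j\le n+1$ and $j\equiv n+1 \pmod 2$ such that $(k\;\,k+1)$ is a cycle of $\sigma$ for every $k\in\{j,j+2,\dots,n-1\}$ (so $j=n+1$ if $\sigma$ does not end with such a run of transpositions). Then $j\ge 2$; put $a=\sigma(j-1)$. Then $\alpha_n(\sigma)=\tau$, where: Case 1: if $\sigma(a)=j-1$ (i.e. $j-1$ lies in a $2$-cycle of $\sigma$), let $b=\sigma(j-2)$; then $\tau(j-2)=a$, $\tau(a)=b$, $\tau(x)=\sigma(x)$ for all other $x<j-1$, $\tau$ interchanges $k$ and $k+1$ for each $k\in\{j-1,j+1,\dots,n-2\}$, and $\tau(n)=n$. (In cycle notation: $\sigma=(\cdots)(\cdots\, j-2\;\, b\,\cdots)(j-1\;\,a)(j\;\,j+1)\cdots(n-1\;\,n)$ is sent to $(\cdots)(\cdots\, j-2\;\,a\;\,b\,\cdots)(j-1\;\,j)\cdots(n-2\;\,n-1)(n)$.) Case 2: if $\sigma(a)\ne j-1$ (i.e. $j-1$ lies in a cycle of length at least $3$), let $b=\sigma(a)$; then $\tau(j-1)=b$ and $\tau(x)=\sigma(x)$ for all $x<j$ with $x\notin\{j-1,a\}$; if $j=n+1$ then $\tau(a)=a$; if $j\le n-1$ then $\tau(j)=a$, $\tau(a)=j$, $\tau$ interchanges $k$ and $k+1$ for each $k\in\{j+1,j+3,\dots,n-2\}$, and $\tau(n)=n$.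 (In cycle notation: $\sigma=(\cdots)(\cdots\, j-1\;\,a\;\,b\,\cdots)(j\;\,j+1)\cdots(n-1\;\,n)$ is sent to $(\cdots)(\cdots\, j-1\;\,b\,\cdots)(j\;\,a)(j+1\;\,j+2)\cdots(n-2\;\,n-1)(n)$, with all entries greater than $n$ deleted.)
   Context: For $n \geq 0$ let $\mathfrak{S}_n$ be the set of permutations of $[n]=\{1,\dots,n\}$ ($\mathfrak{S}_0$ consists of the empty permutation $()$), written in disjoint cycle notation. Let $D_n\subseteq \mathfrak{S}_n$ be the set of derangements (permutations with no fixed point) and $E_n \subseteq \mathfrak{S}_n$ the set of permutations with exactly one fixed point. Define $\pi_n = (1\,2)(3\,4)\cdots(n-1\;n)$ if $n$ is even and $\pi_n=(1\,2)(3\,4)\cdots(n-2\;\,n-1)(n)$ if $n$ is odd; so $\pi_0=()$, $\pi_1=(1)$, $\pi_n\in D_n$ for $n$ even and $\pi_n \in E_n$ for $n$ odd. Let $\Pi_n=\{\pi_n\}$. For $\sigma\in\mathfrak{S}_n$ and $a\in[n]$, $\sigma\setminus a$ denotes the permutation of $[n]\setminus\{a\}$ obtained by deleting $a$ from the disjoint cycle decomposition of $\sigma$: $(\sigma\setminus a)(x)=\sigma(x)$ if $\sigma(x)\neq a$, and $(\sigma\setminus a)(\sigma^{ -1}(a))=\sigma(a)$ if $\sigma(a)\ne a$. In particular $\sigma\setminus n\in\mathfrak{S}_{n-1}$. For $n\ge 1$ define the bijection $f_n:[n]\times D_{n-1}\to E_n$ by: for $m<n$, $f_n(m,\sigma)$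 is the permutation $\tau$ of $[n]$ obtained by replacing $m$ by $n$ in the cycle decomposition of $\sigma$ and adding the fixed point $m$ (i.e. $\tau(m)=m$, $\tau(\sigma^{ -1}(m))=n$, $\tau(n)=\sigma(m)$, $\tau(x)=\sigma(x)$ otherwise); and $f_n(n,\sigma)$ is $\sigma$ with the fixed point $n$ appended. Define bijections $\alpha_n$ recursively: for $n$ even, $\alpha_n: D_n\to E_n\sqcup \Pi_n$; for $n$ odd, $\alpha_n: D_n\sqcup\Pi_n\to E_n$ (these unions are disjoint). Let $\alpha_0$ send $()$ to $\pi_0$ and $\alpha_1$ send $\pi_1$ to $(1)$. For $n\ge 2$ and $\sigma$ in the domain of $\alpha_n$, with $\alpha_{n-1}^{ -1}$ the inverse of the bijection $\alpha_{n-1}$: (i) if $\sigma\in D_n$ and $n$ lies in a cycle of $\sigma$ of length at least $3$, then $\alpha_n(\sigma)=f_n(\sigma(n),\sigma\setminus n)$; (ii) if $\sigma\in D_n$ and $n$ lies in a $2$-cycle of $\sigma$, then $\sigma\setminus n\in E_{n-1}$; let $\rho=\alpha_{n-1}^{ -1}(\sigma\setminus n)$. If $\rho\in D_{n-1}$, then $\alpha_n(\sigma)=f_n(n,\rho)$; if $\rho=\pi_{n-1}\in\Pi_{n-1}$ (possible only for $n$ even), then $\alpha_n(\sigma)=\pi_n\in\Pi_n$; (iii) if $n$ is odd and $\sigma=\pi_n\in\Pi_n$, then $\alpha_n(\pi_n)=f_n\big(n,\alpha_{n-1}^{ -1}(\pi_{n-1})\big)$, where $\pi_{n-1}$ is regarded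 as the element of $\Pi_{n-1}$ in the domain of $\alpha_{n-1}^{ -1}$. -}

module Defs where

open import Data.Nat using (ℕ; zero; suc; _+_; _*_; _∸_; _≤_; _<_; _≡ᵇ_; _<ᵇ_; _%_)
open import Data.Bool using (Bool; true; false; if_then_else_)
open import Data.Product using (_×_; Σ; ∃)
open import Data.Empty using (⊥)
open import Relation.Nullary using (¬_)
open import Relation.Binary.PropositionalEquality using (_≡_; _≢_)

-- A permutation of [n] = {1,…,n} is represented by a function ℕ → ℕ;
-- only its values on [n] matter.  Two such functions represent the same
-- permutation of [n] iff they agree on [n].
Agree : ℕ → (ℕ → ℕ) → (ℕ → ℕ) → Set
Agree n σ τ = ∀ x → 1 ≤ x → x ≤ n → σ x ≡ τ x

IsPerm : ℕ → (ℕ → ℕ) → Set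
IsPerm n σ =
  (∀ x → 1 ≤ x → x ≤ n → (1 ≤ σ x) × (σ x ≤ n)) ×
  (∀ x y → 1 ≤ x → x ≤ n → 1 ≤ y → y ≤ n → σ x ≡ σ y → x ≡ y)

IsDer : ℕ → (ℕ → ℕ) → Set
IsDer n σ = IsPerm n σ × (∀ x → 1 ≤ x → x ≤ n → σ x ≢ x)

pi : ℕ → ℕ → ℕ
pi n x = if x % 2 ≡ᵇ 0 then x ∸ 1 else (if x <ᵇ n then suc x else x)

-- σ ∖ a : delete a from the cycle decomposition of σ
del : ℕ → (ℕ → ℕ) → ℕ → ℕ
del a σ x = if σ x ≡ᵇ a then σ a else σ x

-- f_n(m, σ) (for m < n: replace m by n and add the fixed point m;
-- for m = n: append the fixed point n)
f : ℕ → ℕ → (ℕ → ℕ) → ℕ → ℕ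
f n m σ x =
  if m ≡ᵇ n
  then (if x ≡ᵇ n then n else σ x)
  else (if x ≡ᵇ m then m
        else (if x ≡ᵇ n then σ m
              else (if σ x ≡ᵇ m then n else σ x)))

-- Alpha n σ τ : the graph of α_n, i.e. α_n(σ) = τ (as permutations of [n]).
-- The disjoint unions D_n ⊔ Π_n and E_n ⊔ Π_n are faithfully represented by
-- raw permutations since the summands are disjoint sets of permutations.
-- α_{n-1}^{-1}(y) = ρ is expressed as Alpha (n-1) ρ y.
data Alpha : ℕ → (ℕ → ℕ) → (ℕ → ℕ) → Set where
  a0 : ∀ {σ τ} → Alpha 0 σ τ
  a1 : ∀ {σ τ} → σ 1 ≡ 1 → τ 1 ≡ 1 → Alpha 1 σ τ
  ai : ∀ {k σ τ} → let n = suc (suc k) in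
       IsDer n σ → σ (σ n) ≢ n →
       Agree n τ (f n (σ n) (del n σ)) →
       Alpha n σ τ
  aii-D : ∀ {k σ τ} (ρ : ℕ → ℕ) → let n = suc (suc k) in
       IsDer n σ → σ (σ n) ≡ n →
       Alpha (suc k) ρ (del n σ) → IsDer (suc k) ρ →
       Agree n τ (f n n ρ) →
       Alpha n σ τ
  aii-Π : ∀ {k σ τ} (ρ : ℕ → ℕ) → let n = suc (suc k) in
       n % 2 ≡ 0 →
       IsDer n σ → σ (σ n) ≡ n →
       Alpha (suc k) ρ (del n σ) → Agree (suc k) ρ (pi (suc k)) →
       Agree n τ (pi n) →
       Alpha n σ τ
  aiii : ∀ {k σ τ} (ρ : ℕ → ℕ) → let n = suc (suc k) in
       n % 2 ≡ 1 →
       Agree n σ (pi n) →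
       Alpha (suc k) ρ (pi (suc k)) →
       Agree n τ (f n n ρ) →
       Alpha n σ τ

TrailRun : ℕ → (ℕ → ℕ) → ℕ → Set
TrailRun n σ j = ∀ i → j + 2 * i + 1 ≤ n →
  (σ (j + 2 * i) ≡ j + 2 * i + 1) × (σ (j + 2 * i + 1) ≡ j + 2 * i)

RunStart : ℕ → (ℕ → ℕ) → ℕ → Set
RunStart n σ j = (1 ≤ j) × (∃ λ i → j + 2 * i ≡ suc n) × TrailRun n σ j

MinRunStart : ℕ → (ℕ → ℕ) → ℕ → Set
MinRunStart n σ j = RunStart n σ j × (∀ j' → RunStart n σ j' → j ≤ j')

Case1 : ℕ → (ℕ → ℕ) → ℕ → (ℕ → ℕ) → Set
Case1 n σ j τ =
  (τ (j ∸ 2) ≡ a) × (τ a ≡ b) ×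
  (∀ x → 1 ≤ x → x < j ∸ 1 → x ≢ j ∸ 2 → x ≢ a → τ x ≡ σ x) ×
  (∀ i → (j ∸ 1) + 2 * i + 2 ≤ n →
     (τ ((j ∸ 1) + 2 * i) ≡ (j ∸ 1) + 2 * i + 1) ×
     (τ ((j ∸ 1) + 2 * i + 1) ≡ (j ∸ 1) + 2 * i)) ×
  (τ n ≡ n)
  where
  a = σ (j ∸ 1)
  b = σ (j ∸ 2)

Case2 : ℕ → (ℕ → ℕ) → ℕ → (ℕ → ℕ) → Set
Case2 n σ j τ =
  (τ (j ∸ 1) ≡ b) ×
  (∀ x → 1 ≤ x → x < j → x ≢ j ∸ 1 → x ≢ a → τ x ≡ σ x) ×
  (j ≡ suc n → τ a ≡ a) ×
  (j + 1 ≤ n →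
     (τ j ≡ a) × (τ a ≡ j) ×
     (∀ i → (j + 1) + 2 * i + 2 ≤ n →
        (τ ((j + 1) + 2 * i) ≡ (j + 1) + 2 * i + 1) ×
        (τ ((j + 1) + 2 * i + 1) ≡ (j + 1) + 2 * i)) ×
     (τ n ≡ n))
  where
  a = σ (j ∸ 1)
  b = σ a

-- α_n(π_n) = π_n by induction on n, alternating rule (ii) for n even
-- (π_n ∖ n = π_{n-1}) with rule (iii) for n odd (π_n is π_{n-1} with n appended).
-- For a derangement σ ≠ π_n both cases are proved by a simultaneous induction on n.
-- If j = n+1, Case 2 is rule (i) written out, and in Case 1 rule (ii) applies with
-- ρ = τ|[n-1], because rule (i) at n-1 sends this ρ to σ ∖ n.  If j ≤ n-1, σ ends
-- with the 2-cycle (n-1 n), so rule (ii) reduces α_n(σ) to α_{n-1}^{-1}(σ ∖ n); now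
-- τ|[n-1] is a derangement whose minimal run start is j-1 (Case 1) resp. j+1
-- (Case 2), and the formula of the other case at n-1 sends it to σ ∖ n.  That τ is
-- a permutation is seen by writing it below the run as σ composed with a
-- transposition or a 3-cycle, with one point deleted or appended.

module Submission where

open import Defs
open import Data.Bool using (true; false; if_then_else_; T)
open import Data.Empty using (⊥-elim)
open import Data.Nat
open import Data.Nat.DivMod using (m*n%n≡0; [m+kn]%n≡m%n)
open import Data.Nat.Properties
open import Data.Nat.Tactic.RingSolver using (solve-∀)
open import Data.Product using (_×_; _,_; proj₁; proj₂; ∃)
open import Data.Sum using (_⊎_; inj₁; inj₂)
open import Data.Unit using (tt)
open import Function using (_∘_)
open import Relation.Nullary using (¬_; yes; no; contradiction)
open import Relation.Binary.PropositionalEquality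

+-2*-suc : ∀ m r → m + 2 * suc r ≡ suc (suc (m + 2 * r))
+-2*-suc = solve-∀

if-T : ∀ {A : Set} {b} {x y : A} → T b → (if b then x else y) ≡ x
if-T {b = true} _ = refl

if-¬T : ∀ {A : Set} {b} {x y : A} → ¬ T b → (if b then x else y) ≡ y
if-¬T {b = false} _   = refl
if-¬T {b = true}  ¬tt = contradiction tt ¬tt

if-≡ : ∀ {A : Set} {m n} {x y : A} → m ≡ n → (if m ≡ᵇ n then x else y) ≡ x
if-≡ {m = m} {n} m≡n = if-T (≡⇒≡ᵇ m n m≡n)

if-≢ : ∀ {A : Set} {m n} {x y : A} → m ≢ n → (if m ≡ᵇ n then x else y) ≡ y
if-≢ {m = m} {n} m≢n = if-¬T (m≢n ∘ ≡ᵇ⇒≡ m n)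

if-< : ∀ {A : Set} {m n} {x y : A} → m < n → (if m <ᵇ n then x else y) ≡ x
if-< m<n = if-T (<⇒<ᵇ m<n)

if-≮ : ∀ {A : Set} {m n} {x y : A} → ¬ m < n → (if m <ᵇ n then x else y) ≡ y
if-≮ {m = m} {n} m≮n = if-¬T (m≮n ∘ <ᵇ⇒< m n)

del-hit : ∀ {a σ x} → σ x ≡ a → del a σ x ≡ σ a
del-hit {a} {σ} {x} = if-≡ {m = σ x} {a}

del-miss : ∀ {a σ x} → σ x ≢ a → del a σ x ≡ σ x
del-miss {a} {σ} {x} = if-≢ {m = σ x} {a}

f-top : ∀ {n ρ} → f n n ρ n ≡ n
f-top {n} = trans (if-≡ {m = n} refl) (if-≡ {m = n} refl)

f-below : ∀ {n ρ x} → x ≢ n → f n n ρ x ≡ ρ x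
f-below {n} x≢n = trans (if-≡ {m = n} refl) (if-≢ x≢n)

f-fixed : ∀ {n m ρ} → m ≢ n → f n m ρ m ≡ m
f-fixed {m = m} m≢n = trans (if-≢ m≢n) (if-≡ {m = m} refl)

f-new : ∀ {n m ρ} → m ≢ n → f n m ρ n ≡ ρ m
f-new {n} m≢n = trans (if-≢ m≢n) (trans (if-≢ (m≢n ∘ sym)) (if-≡ {m = n} refl))

f-redirect : ∀ {n m ρ x} → m ≢ n → x ≢ m → x ≢ n → ρ x ≡ m → f n m ρ x ≡ n
f-redirect m≢n x≢m x≢n ρx≡m =
  trans (if-≢ m≢n) (trans (if-≢ x≢m) (trans (if-≢ x≢n) (if-≡ ρx≡m)))

f-keep : ∀ {n m ρ x} → m ≢ n → x ≢ m → x ≢ n → ρ x ≢ m → f n m ρ x ≡ ρ x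
f-keep m≢n x≢m x≢n ρx≢m =
  trans (if-≢ m≢n) (trans (if-≢ x≢m) (trans (if-≢ x≢n) (if-≢ ρx≢m)))

swap : ℕ → ℕ → ℕ → ℕ
swap a b x = if x ≡ᵇ a then b else (if x ≡ᵇ b then a else x)

swap-left : ∀ {a b} → swap a b a ≡ b
swap-left {a} = if-≡ {m = a} refl

swap-right : ∀ {a b} → swap a b b ≡ a
swap-right {a} {b} with b ≟ a
... | yes b≡a = trans (if-≡ b≡a) b≡a
... | no  b≢a = trans (if-≢ b≢a) (if-≡ {m = b} refl)

swap-other : ∀ {a b x} → x ≢ a → x ≢ b → swap a b x ≡ x
swap-other x≢a x≢b = trans (if-≢ x≢a) (if-≢ x≢b)

swap-involutive : ∀ {a b} x → swap a b (swap a b x) ≡ x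
swap-involutive {a} {b} x with x ≟ a | x ≟ b
... | yes refl | _        = trans (cong (swap a b) (swap-left {a} {b})) (swap-right {a} {b})
... | no  _    | yes refl = trans (cong (swap a b) (swap-right {a} {b})) (swap-left {a} {b})
... | no  x≢a  | no  x≢b  = trans (cong (swap a b) (swap-other x≢a x≢b)) (swap-other x≢a x≢b)

≤-suc-split : ∀ {x n} → x ≤ suc n → x ≤ n ⊎ x ≡ suc n
≤-suc-split x≤1+n with m≤n⇒m<n∨m≡n x≤1+n
... | inj₁ x<1+n = inj₁ (m<1+n⇒m≤n x<1+n)
... | inj₂ x≡1+n = inj₂ x≡1+n

IsPerm-cong : ∀ {n σ τ} → Agree n σ τ → IsPerm n σ → IsPerm n τ
IsPerm-cong {n} σ≈τ (range , inj) =
  (λ x 1≤x x≤n → subst (λ v → 1 ≤ v × v ≤ n) (σ≈τ x 1≤x x≤n) (range x 1≤x x≤n)) ,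
  (λ x y 1≤x x≤n 1≤y y≤n τx≡τy →
    inj x y 1≤x x≤n 1≤y y≤n (trans (σ≈τ x 1≤x x≤n) (trans τx≡τy (sym (σ≈τ y 1≤y y≤n)))))

IsPerm-∘ : ∀ {n σ ρ} → IsPerm n σ → IsPerm n ρ → IsPerm n (σ ∘ ρ)
IsPerm-∘ (σ-range , σ-inj) (ρ-range , ρ-inj) =
  (λ x 1≤x x≤n → let 1≤ρx , ρx≤n = ρ-range x 1≤x x≤n in σ-range _ 1≤ρx ρx≤n) ,
  (λ x y 1≤x x≤n 1≤y y≤n σρx≡σρy →
    let 1≤ρx , ρx≤n = ρ-range x 1≤x x≤n
        1≤ρy , ρy≤n = ρ-range y 1≤y y≤n
    in ρ-inj x y 1≤x x≤n 1≤y y≤n (σ-inj _ _ 1≤ρx ρx≤n 1≤ρy ρy≤n σρx≡σρy))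

IsPerm-involution : ∀ {n g} → (∀ x → 1 ≤ x → x ≤ n → (1 ≤ g x) × (g x ≤ n)) →
  (∀ x → 1 ≤ x → x ≤ n → g (g x) ≡ x) → IsPerm n g
IsPerm-involution {g = g} range invol =
  range ,
  (λ x y 1≤x x≤n 1≤y y≤n gx≡gy →
    trans (sym (invol x 1≤x x≤n)) (trans (cong g gx≡gy) (invol y 1≤y y≤n)))

IsPerm-swap : ∀ {n a b} → 1 ≤ a → a ≤ n → 1 ≤ b → b ≤ n → IsPerm n (swap a b)
IsPerm-swap {n} {a} {b} 1≤a a≤n 1≤b b≤n = IsPerm-involution range (λ x _ _ → swap-involutive x)
  where
  range : ∀ x → 1 ≤ x → x ≤ n → (1 ≤ swap a b x) × (swap a b x ≤ n)
  range x 1≤x x≤n with x ≟ a | x ≟ b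
  ... | yes refl | _        rewrite swap-left {x} {b}  = 1≤b , b≤n
  ... | no  _    | yes refl rewrite swap-right {a} {x} = 1≤a , a≤n
  ... | no  x≢a  | no  x≢b  rewrite swap-other {a} {b} x≢a x≢b = 1≤x , x≤n

IsPerm-extend : ∀ {n ρ} → IsPerm n ρ → IsPerm (suc n) (f (suc n) (suc n) ρ)
IsPerm-extend {n} {ρ} (range , inj) = range′ , inj′
  where
  g = f (suc n) (suc n) ρ
  g-below : ∀ {x} → x ≤ n → g x ≡ ρ x
  g-below x≤n = f-below {suc n} {ρ} (<⇒≢ (s≤s x≤n))
  range′ : ∀ x → 1 ≤ x → x ≤ suc n → (1 ≤ g x) × (g x ≤ suc n)
  range′ x 1≤x x≤1+n with ≤-suc-split x≤1+n
  ... | inj₂ refl rewrite f-top {suc n} {ρ} = s≤s z≤n , ≤-refl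
  ... | inj₁ x≤n rewrite g-below x≤n =
    let 1≤ρx , ρx≤n = range x 1≤x x≤n in 1≤ρx , m≤n⇒m≤1+n ρx≤n
  top≢below : ∀ {y} → 1 ≤ y → y ≤ n → g (suc n) ≢ g y
  top≢below {y} 1≤y y≤n gn≡gy = 1+n≰n (subst (_≤ n) ρy≡1+n (proj₂ (range y 1≤y y≤n)))
    where ρy≡1+n = trans (sym (g-below y≤n)) (trans (sym gn≡gy) (f-top {suc n} {ρ}))
  inj′ : ∀ x y → 1 ≤ x → x ≤ suc n → 1 ≤ y → y ≤ suc n → g x ≡ g y → x ≡ y
  inj′ x y 1≤x x≤1+n 1≤y y≤1+n gx≡gy with ≤-suc-split x≤1+n | ≤-suc-split y≤1+n
  ... | inj₂ refl  | inj₂ refl  = refl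
  ... | inj₂ refl  | inj₁ y≤n   = contradiction gx≡gy (top≢below 1≤y y≤n)
  ... | inj₁ x≤n   | inj₂ refl  = contradiction (sym gx≡gy) (top≢below 1≤x x≤n)
  ... | inj₁ x≤n   | inj₁ y≤n   =
    inj x y 1≤x x≤n 1≤y y≤n (trans (sym (g-below x≤n)) (trans gx≡gy (g-below y≤n)))

IsPerm-del : ∀ {n σ} → IsPerm (suc n) σ → IsPerm n (del (suc n) σ)
IsPerm-del {n} {σ} (range , inj) = range′ , inj′
  where
  top≢ : ∀ {x} → 1 ≤ x → x ≤ n → suc n ≢ x
  top≢ _ x≤n refl = 1+n≰n x≤n
  ≤n : ∀ {x} → 1 ≤ x → x ≤ suc n → σ x ≢ suc n → σ x ≤ n
  ≤n {x} 1≤x x≤1+n σx≢1+n = m<1+n⇒m≤n (≤∧≢⇒< (proj₂ (range x 1≤x x≤1+n)) σx≢1+n)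
  σtop≢top : ∀ {x} → 1 ≤ x → x ≤ n → σ x ≡ suc n → σ (suc n) ≢ suc n
  σtop≢top {x} 1≤x x≤n σx≡1+n σtop≡1+n =
    top≢ 1≤x x≤n
      (inj (suc n) x (s≤s z≤n) ≤-refl 1≤x (m≤n⇒m≤1+n x≤n) (trans σtop≡1+n (sym σx≡1+n)))
  range′ : ∀ x → 1 ≤ x → x ≤ n → (1 ≤ del (suc n) σ x) × (del (suc n) σ x ≤ n)
  range′ x 1≤x x≤n with σ x ≟ suc n
  ... | yes σx≡1+n rewrite del-hit {suc n} {σ} {x} σx≡1+n =
    proj₁ (range (suc n) (s≤s z≤n) ≤-refl) , ≤n (s≤s z≤n) ≤-refl (σtop≢top 1≤x x≤n σx≡1+n)
  ... | no  σx≢1+n rewrite del-miss {suc n} {σ} {x} σx≢1+n =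
    proj₁ (range x 1≤x (m≤n⇒m≤1+n x≤n)) , ≤n 1≤x (m≤n⇒m≤1+n x≤n) σx≢1+n
  inj′ : ∀ x y → 1 ≤ x → x ≤ n → 1 ≤ y → y ≤ n → del (suc n) σ x ≡ del (suc n) σ y → x ≡ y
  inj′ x y 1≤x x≤n 1≤y y≤n eq with σ x ≟ suc n | σ y ≟ suc n
  ... | yes σx≡1+n | yes σy≡1+n =
    inj x y 1≤x (m≤n⇒m≤1+n x≤n) 1≤y (m≤n⇒m≤1+n y≤n) (trans σx≡1+n (sym σy≡1+n))
  ... | yes σx≡1+n | no  σy≢1+n = contradiction
    (inj (suc n) y (s≤s z≤n) ≤-refl 1≤y (m≤n⇒m≤1+n y≤n)
      (trans (sym (del-hit {suc n} {σ} {x} σx≡1+n)) (trans eq (del-miss {suc n} {σ} {y} σy≢1+n))))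
    (top≢ 1≤y y≤n)
  ... | no  σx≢1+n | yes σy≡1+n = contradiction
    (inj (suc n) x (s≤s z≤n) ≤-refl 1≤x (m≤n⇒m≤1+n x≤n)
      (trans (sym (del-hit {suc n} {σ} {y} σy≡1+n)) (trans (sym eq) (del-miss {suc n} {σ} {x} σx≢1+n))))
    (top≢ 1≤x x≤n)
  ... | no  σx≢1+n | no  σy≢1+n = inj x y 1≤x (m≤n⇒m≤1+n x≤n) 1≤y (m≤n⇒m≤1+n y≤n)
    (trans (sym (del-miss {suc n} {σ} {x} σx≢1+n)) (trans eq (del-miss {suc n} {σ} {y} σy≢1+n)))

IsPerm-restrict : ∀ {m n σ} → m ≤ n → (∀ x → 1 ≤ x → x ≤ m → σ x ≤ m) → IsPerm n σ → IsPerm m σ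
IsPerm-restrict m≤n closed (range , inj) =
  (λ x 1≤x x≤m → proj₁ (range x 1≤x (≤-trans x≤m m≤n)) , closed x 1≤x x≤m) ,
  (λ x y 1≤x x≤m 1≤y y≤m → inj x y 1≤x (≤-trans x≤m m≤n) 1≤y (≤-trans y≤m m≤n))

≤-2+-split : ∀ {x k} → x ≤ suc (suc k) → x ≤ k ⊎ x ≡ suc k ⊎ x ≡ suc (suc k)
≤-2+-split x≤2+k with ≤-suc-split x≤2+k
... | inj₂ x≡2+k = inj₂ (inj₂ x≡2+k)
... | inj₁ x≤1+k with ≤-suc-split x≤1+k
...   | inj₁ x≤k   = inj₁ x≤k
...   | inj₂ x≡1+k = inj₂ (inj₁ x≡1+k)

IsDer-extend-pair : ∀ {k g} → IsDer k g → g (suc k) ≡ suc (suc k) → g (suc (suc k)) ≡ suc k →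
  IsDer (suc (suc k)) g
IsDer-extend-pair {k} {g} (perm , der) g[1+k] g[2+k] = IsPerm-cong agree perm′ , der′
  where
  open ≡-Reasoning
  g⁺ = f (suc (suc k)) (suc (suc k)) (f (suc k) (suc k) g)
  h = g⁺ ∘ swap (suc k) (suc (suc k))
  perm′ : IsPerm (suc (suc k)) h
  perm′ = IsPerm-∘ (IsPerm-extend (IsPerm-extend perm)) (IsPerm-swap (s≤s z≤n) (n≤1+n _) (s≤s z≤n) ≤-refl)
  agree : Agree (suc (suc k)) h g
  agree x _ x≤2+k with ≤-2+-split x≤2+k
  ... | inj₁ x≤k = begin
    h x                   ≡⟨ cong g⁺ (swap-other {suc k} {suc (suc k)} x≢1+k x≢2+k) ⟩
    g⁺ x                  ≡⟨ f-below {suc (suc k)} {f (suc k) (suc k) g} x≢2+k ⟩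
    f (suc k) (suc k) g x ≡⟨ f-below {suc k} {g} x≢1+k ⟩
    g x                   ∎
    where
    x≢1+k = <⇒≢ (s≤s x≤k)
    x≢2+k = <⇒≢ (m≤n⇒m≤1+n (s≤s x≤k))
  ... | inj₂ (inj₁ refl) = begin
    h (suc k)        ≡⟨ cong g⁺ (swap-left {suc k} {suc (suc k)}) ⟩
    g⁺ (suc (suc k)) ≡⟨ f-top {suc (suc k)} {f (suc k) (suc k) g} ⟩
    suc (suc k)      ≡⟨ g[1+k] ⟨
    g (suc k)        ∎
  ... | inj₂ (inj₂ refl) = begin
    h (suc (suc k))             ≡⟨ cong g⁺ (swap-right {suc k} {suc (suc k)}) ⟩
    g⁺ (suc k)                  ≡⟨ f-below {suc (suc k)} {f (suc k) (suc k) g} (<⇒≢ ≤-refl) ⟩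
    f (suc k) (suc k) g (suc k) ≡⟨ f-top {suc k} {g} ⟩
    suc k                       ≡⟨ g[2+k] ⟨
    g (suc (suc k))             ∎
  der′ : ∀ x → 1 ≤ x → x ≤ suc (suc k) → g x ≢ x
  der′ x 1≤x x≤2+k with ≤-2+-split x≤2+k
  ... | inj₁ x≤k         = der x 1≤x x≤k
  ... | inj₂ (inj₁ refl) = λ gx≡x → 1+n≢n (trans (sym g[1+k]) gx≡x)
  ... | inj₂ (inj₂ refl) = λ gx≡x → 1+n≢n (trans (sym gx≡x) g[2+k])

TrailRun-mono : ∀ {m n σ j} → m ≤ n → TrailRun n σ j → TrailRun m σ j
TrailRun-mono m≤n run i top≤m = run i (≤-trans top≤m m≤n)

IsDer-extend-run : ∀ {c m g} r → IsDer c g → TrailRun m g (suc c) → c + 2 * r ≡ m → IsDer m g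
IsDer-extend-run {c} {g = g} zero    der _   refl = subst (λ t → IsDer t g) (sym (+-identityʳ c)) der
IsDer-extend-run {c} {g = g} (suc r) der run refl =
  subst (λ t → IsDer t g) (sym (+-2*-suc c r))
    (IsDer-extend-pair (IsDer-extend-run r der (TrailRun-mono {σ = g} {j = suc c} c+2r≤m run) refl)
      (trans (proj₁ pair) (+-comm _ 1)) (trans (cong g (sym (+-comm _ 1))) (proj₂ pair)))
  where
  c+2r≤m : c + 2 * r ≤ c + 2 * suc r
  c+2r≤m = subst (c + 2 * r ≤_) (sym (+-2*-suc c r)) (m≤n⇒m≤1+n (n≤1+n _))
  pair : (g (suc (c + 2 * r)) ≡ suc (c + 2 * r) + 1) × (g (suc (c + 2 * r) + 1) ≡ suc (c + 2 * r))
  pair = run r (subst (_≤ c + 2 * suc r) (sym (+-comm _ 1))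
                  (subst (suc (suc (c + 2 * r)) ≤_) (sym (+-2*-suc c r)) ≤-refl))

Agree-retarget : ∀ {n τ τ′ ρ} → Agree n τ τ′ → Agree n τ ρ → Agree n τ′ ρ
Agree-retarget τ≈τ′ τ≈ρ x 1≤x x≤n = trans (sym (τ≈τ′ x 1≤x x≤n)) (τ≈ρ x 1≤x x≤n)

Alpha-cong : ∀ {n σ τ τ′} → Agree n τ τ′ → Alpha n σ τ → Alpha n σ τ′
Alpha-cong τ≈τ′ a0                          = a0
Alpha-cong τ≈τ′ (a1 σ1≡1 τ1≡1)              = a1 σ1≡1 (trans (sym (τ≈τ′ 1 ≤-refl ≤-refl)) τ1≡1)
Alpha-cong τ≈τ′ (ai der h τ≈)               = ai der h (Agree-retarget τ≈τ′ τ≈)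
Alpha-cong τ≈τ′ (aii-D ρ der h α derρ τ≈)   = aii-D ρ der h α derρ (Agree-retarget τ≈τ′ τ≈)
Alpha-cong τ≈τ′ (aii-Π ρ ev der h α ρ≈ τ≈) = aii-Π ρ ev der h α ρ≈ (Agree-retarget τ≈τ′ τ≈)
Alpha-cong τ≈τ′ (aiii ρ od σ≈ α τ≈)         = aiii ρ od σ≈ α (Agree-retarget τ≈τ′ τ≈)

even-or-odd : ∀ d → ∃ λ i → d ≡ 2 * i ⊎ d ≡ suc (2 * i)
even-or-odd zero = 0 , inj₁ refl
even-or-odd (suc d) with even-or-odd d
... | i , inj₁ d≡2i   = i , inj₂ (cong suc d≡2i)
... | i , inj₂ d≡1+2i = suc i , inj₁ (trans (cong suc d≡1+2i) (sym (+-2*-suc 0 i)))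

[2*i]%2≡0 : ∀ i → (2 * i) % 2 ≡ 0
[2*i]%2≡0 i = trans (cong (_% 2) (*-comm 2 i)) (m*n%n≡0 i 2)

[1+2*i]%2≡1 : ∀ i → suc (2 * i) % 2 ≡ 1
[1+2*i]%2≡1 i = trans (cong (λ t → suc t % 2) (*-comm 2 i)) ([m+kn]%n≡m%n 1 i 2)

pi-odd : ∀ m x → x % 2 ≡ 1 → x < m → pi m x ≡ suc x
pi-odd m x odd x<m = trans (if-≢ {m = x % 2} (λ eq → 1+n≢n (trans (sym odd) eq))) (if-< x<m)

pi-odd-last : ∀ m x → x % 2 ≡ 1 → ¬ x < m → pi m x ≡ x
pi-odd-last m x odd x≮m = trans (if-≢ {m = x % 2} (λ eq → 1+n≢n (trans (sym odd) eq))) (if-≮ x≮m)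

-- (2 + x) % 2 and x % 2 are definitionally equal.
pi-even : ∀ m i → pi m (suc (suc (2 * i))) ≡ suc (2 * i)
pi-even m i = if-≡ {m = (2 * i) % 2} ([2*i]%2≡0 i)

pi-indep : ∀ m m′ x → x < m → x < m′ → pi m x ≡ pi m′ x
pi-indep m m′ x x<m x<m′ =
  cong (λ v → if x % 2 ≡ᵇ 0 then x ∸ 1 else v) (trans (if-< x<m) (sym (if-< x<m′)))

pi-≤-suc : ∀ m x → pi m x ≤ suc x
pi-≤-suc m x with x % 2 ≡ᵇ 0 | x <ᵇ m
... | true  | _     = ≤-trans (m∸n≤m x 1) (n≤1+n x)
... | false | true  = ≤-refl
... | false | false = n≤1+n x

IsDer-zero : ∀ g → IsDer 0 g
IsDer-zero g = ((λ _ 1≤x x≤0 → contradiction x≤0 (<⇒≱ 1≤x)) ,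
                (λ _ _ 1≤x x≤0 _ _ _ → contradiction x≤0 (<⇒≱ 1≤x))) ,
               (λ _ 1≤x x≤0 → contradiction x≤0 (<⇒≱ 1≤x))

pi-IsDer : ∀ r → IsDer (2 * r) (pi (2 * r))
pi-IsDer r = IsDer-extend-run r (IsDer-zero _) run refl
  where
  run : TrailRun (2 * r) (pi (2 * r)) 1
  run i 2+2i≤2r =
    trans (pi-odd (2 * r) (1 + 2 * i) ([1+2*i]%2≡1 i) (subst (_≤ 2 * r) (+-comm (1 + 2 * i) 1) 2+2i≤2r))
          (+-comm 1 (1 + 2 * i)) ,
    trans (cong (pi (2 * r)) (+-comm (1 + 2 * i) 1)) (pi-even (2 * r) i)

del-pi : ∀ r → Agree (1 + 2 * r) (pi (1 + 2 * r)) (del (2 + 2 * r) (pi (2 + 2 * r)))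
del-pi r x _ x≤1+2r with x ≟ suc (2 * r)
... | yes refl = trans (pi-odd-last (1 + 2 * r) x ([1+2*i]%2≡1 r) (n≮n _))
  (sym (trans (del-hit {2 + 2 * r} {pi (2 + 2 * r)} {x} (pi-odd (2 + 2 * r) x ([1+2*i]%2≡1 r) ≤-refl))
              (pi-even (2 + 2 * r) r)))
... | no  x≢1+2r = trans (pi-indep (1 + 2 * r) (2 + 2 * r) x x<1+2r (m<n⇒m<1+n x<1+2r))
  (sym (del-miss {2 + 2 * r} {pi (2 + 2 * r)} {x} (<⇒≢ (≤-<-trans (pi-≤-suc (2 + 2 * r) x) (s≤s x<1+2r)))))
  where
  x<1+2r = ≤∧≢⇒< x≤1+2r x≢1+2r

f-pi : ∀ r → Agree (3 + 2 * r) (pi (3 + 2 * r)) (f (3 + 2 * r) (3 + 2 * r) (pi (2 + 2 * r)))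
f-pi r x _ x≤3+2r with ≤-suc-split x≤3+2r
... | inj₂ refl = trans (pi-odd-last (3 + 2 * r) x ([1+2*i]%2≡1 r) (n≮n _))
                    (sym (f-top {3 + 2 * r} {pi (2 + 2 * r)}))
... | inj₁ x≤2+2r with ≤-suc-split x≤2+2r
...   | inj₂ refl = trans (pi-even (3 + 2 * r) r)
                      (sym (trans (f-below {3 + 2 * r} {pi (2 + 2 * r)} {x} (<⇒≢ (n<1+n x))) (pi-even (2 + 2 * r) r)))
...   | inj₁ x≤1+2r = trans (pi-indep (3 + 2 * r) (2 + 2 * r) x (s≤s (m≤n⇒m≤1+n x≤1+2r)) (s≤s x≤1+2r))
                        (sym (f-below {3 + 2 * r} {pi (2 + 2 * r)} {x} (<⇒≢ (s≤s (m≤n⇒m≤1+n x≤1+2r)))))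

pi-fixed-even-step : ∀ r → Alpha (1 + 2 * r) (pi (1 + 2 * r)) (pi (1 + 2 * r)) →
  Alpha (2 + 2 * r) (pi (2 + 2 * r)) (pi (2 + 2 * r))
pi-fixed-even-step r α =
  aii-Π (pi (1 + 2 * r)) ([2*i]%2≡0 r) (subst (λ t → IsDer t (pi t)) (+-2*-suc 0 r) (pi-IsDer (suc r)))
    (trans (cong (pi (2 + 2 * r)) (pi-even (2 + 2 * r) r))
           (pi-odd (2 + 2 * r) (1 + 2 * r) ([1+2*i]%2≡1 r) ≤-refl))
    (Alpha-cong (del-pi r) α) (λ _ _ _ → refl) (λ _ _ _ → refl)

pi-fixed-odd-step : ∀ r → Alpha (2 + 2 * r) (pi (2 + 2 * r)) (pi (2 + 2 * r)) →
  Alpha (3 + 2 * r) (pi (3 + 2 * r)) (pi (3 + 2 * r))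
pi-fixed-odd-step r α = aiii (pi (2 + 2 * r)) ([1+2*i]%2≡1 r) (λ _ _ _ → refl) α (f-pi r)

pi-fixed-odd : ∀ r → Alpha (1 + 2 * r) (pi (1 + 2 * r)) (pi (1 + 2 * r))
pi-fixed-odd zero    = a1 refl refl
pi-fixed-odd (suc r) =
  subst (λ t → Alpha t (pi t) (pi t)) (cong suc (sym (+-2*-suc 0 r)))
    (pi-fixed-odd-step r (pi-fixed-even-step r (pi-fixed-odd r)))

pi-fixed : ∀ n → 1 ≤ n → Alpha n (pi n) (pi n)
pi-fixed (suc d) _ with even-or-odd d
... | i , inj₁ refl = pi-fixed-odd i
... | i , inj₂ refl = pi-fixed-even-step i (pi-fixed-odd i)

last-pair< : ∀ j r → j + 2 * r + 1 < j + 2 * suc r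
last-pair< j r = subst₂ _<_ (sym (+-comm (j + 2 * r) 1)) (sym (+-2*-suc j r)) ≤-refl

run-position : ∀ j r x → j ≤ x → x < j + 2 * r →
  ∃ λ i → j + 2 * i + 1 < j + 2 * r × (x ≡ j + 2 * i ⊎ x ≡ j + 2 * i + 1)
run-position j zero x j≤x x<j+0 = contradiction (subst (x <_) (+-identityʳ j) x<j+0) (≤⇒≯ j≤x)
run-position j (suc r) x j≤x x<end with ≤-suc-split (m<1+n⇒m≤n (subst (x <_) (+-2*-suc j r) x<end))
... | inj₂ x≡1+j+2r = r , last-pair< j r , inj₂ (trans x≡1+j+2r (+-comm 1 (j + 2 * r)))
... | inj₁ x≤j+2r with m≤n⇒m<n∨m≡n x≤j+2r
...   | inj₂ x≡j+2r = r , last-pair< j r , inj₁ x≡j+2r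
...   | inj₁ x<j+2r =
  let i , bound , at = run-position j r x j≤x x<j+2r
  in i , <-trans bound (<-trans (m<m+n (j + 2 * r) z<s) (last-pair< j r)) , at

RunStart-≤ : ∀ {n σ j} → RunStart n σ j → j ≤ suc n
RunStart-≤ {j = j} (_ , (r , j+2r≡1+n) , _) = subst (j ≤_) j+2r≡1+n (m≤m+n j (2 * r))

run-pair : ∀ {n σ j r} → TrailRun n σ j → j + 2 * r ≡ suc n → ∀ i → j + 2 * i + 1 < j + 2 * r →
  (σ (j + 2 * i) ≡ j + 2 * i + 1) × (σ (j + 2 * i + 1) ≡ j + 2 * i)
run-pair {j = j} run j+2r≡1+n i bound = run i (m<1+n⇒m≤n (subst (j + 2 * i + 1 <_) j+2r≡1+n bound))

run-preimage : ∀ {n σ j} → RunStart n σ j → ∀ y → j ≤ y → y ≤ n →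
  ∃ λ z → j ≤ z × z ≤ n × σ z ≡ y
run-preimage {n} {σ} {j} (_ , (r , j+2r≡1+n) , run) y j≤y y≤n
  with run-position j r y j≤y (subst (y <_) (sym j+2r≡1+n) (s≤s y≤n))
... | i , bound , inj₁ refl =
  j + 2 * i + 1 , ≤-trans (m≤m+n j (2 * i)) (m≤m+n _ 1) , top≤n ,
  proj₂ (run-pair {n} {σ} {j} {r} run j+2r≡1+n i bound)
  where top≤n = m<1+n⇒m≤n (subst (j + 2 * i + 1 <_) j+2r≡1+n bound)
... | i , bound , inj₂ refl =
  j + 2 * i , m≤m+n j (2 * i) , ≤-trans (m≤m+n _ 1) top≤n ,
  proj₁ (run-pair {n} {σ} {j} {r} run j+2r≡1+n i bound)
  where top≤n = m<1+n⇒m≤n (subst (j + 2 * i + 1 <_) j+2r≡1+n bound)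

run-closed-below : ∀ {n σ p} → IsPerm n σ → RunStart n σ (suc p) → ∀ x → 1 ≤ x → x ≤ p → σ x ≤ p
run-closed-below {n} {σ} {p} (range , inj) start x 1≤x x≤p =
  closed (≤-trans x≤p (m<1+n⇒m≤n (RunStart-≤ {n} {σ} start)))
  where
  closed : x ≤ n → σ x ≤ p
  closed x≤n with σ x ≤? p
  ... | yes σx≤p = σx≤p
  ... | no  σx≰p with run-preimage {n} {σ} {suc p} start (σ x) (≰⇒> σx≰p) (proj₂ (range x 1≤x x≤n))
  ...   | z , p<z , z≤bound , σz≡σx =
    contradiction (inj z x (≤-trans (s≤s z≤n) p<z) z≤bound 1≤x x≤n σz≡σx) (>⇒≢ (≤-<-trans x≤p p<z))

RunStart-1⇒pi : ∀ {n σ} → RunStart n σ 1 → Agree n σ (pi n)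
RunStart-1⇒pi {n} {σ} (_ , (r , 1+2r≡1+n) , run) x 1≤x x≤n
  with run-position 1 r x 1≤x (subst (x <_) (sym 1+2r≡1+n) (s≤s x≤n))
... | i , bound , inj₁ refl =
  trans (proj₁ (run-pair {n} {σ} {1} {r} run 1+2r≡1+n i bound))
    (trans (+-comm (1 + 2 * i) 1) (sym (pi-odd n (1 + 2 * i) ([1+2*i]%2≡1 i) 2+2i≤n)))
  where 2+2i≤n = subst (_≤ n) (+-comm (1 + 2 * i) 1) (m<1+n⇒m≤n (subst (1 + 2 * i + 1 <_) 1+2r≡1+n bound))
... | i , bound , inj₂ refl =
  trans (proj₂ (run-pair {n} {σ} {1} {r} run 1+2r≡1+n i bound))
    (sym (trans (cong (pi n) (+-comm (1 + 2 * i) 1)) (pi-even n i)))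

same-parity-gap : ∀ a b x y → a + 2 * x ≡ b + 2 * y → a < b → ∃ λ e → b ≡ a + 2 * e + 2
same-parity-gap a b zero y eq a<b =
  contradiction (subst (b ≤_) (trans (sym eq) (+-identityʳ a)) (m≤m+n b (2 * y))) (<⇒≱ a<b)
same-parity-gap a b (suc x) zero eq a<b =
  x , trans (sym (+-identityʳ b)) (trans (sym eq) (trans (+-2*-suc a x) (+-comm 2 (a + 2 * x))))
same-parity-gap a b (suc x) (suc y) eq a<b =
  same-parity-gap a b x y (suc-injective (suc-injective
    (trans (sym (+-2*-suc a x)) (trans eq (+-2*-suc b y))))) a<b

MinRunStart-intro : ∀ {n σ j} → RunStart n σ j →
  (∀ q → j ≡ suc (suc q) → 1 ≤ q → σ q ≡ suc q → σ (suc q) ≢ q) → MinRunStart n σ j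
MinRunStart-intro {n} {σ} {j} start@(_ , (r , j+2r≡1+n) , _) no-pair = start , minimal
  where
  minimal : ∀ j′ → RunStart n σ j′ → j ≤ j′
  minimal j′ (1≤j′ , (r′ , j′+2r′≡1+n) , run′) with j ≤? j′
  ... | yes j≤j′ = j≤j′
  ... | no  j≰j′ with same-parity-gap j′ j r′ r (trans j′+2r′≡1+n (sym j+2r≡1+n)) (≰⇒> j≰j′)
  ...   | d , j≡j′+2d+2 = ⊥-elim (no-pair q j≡2+q (≤-trans 1≤j′ (m≤m+n j′ (2 * d)))
      (trans (proj₁ pair) (+-comm q 1)) (trans (cong σ (+-comm 1 q)) (proj₂ pair)))
    where
    q = j′ + 2 * d
    j≡2+q = trans j≡j′+2d+2 (+-comm q 2)
    pair = run′ d (subst (_≤ n) (+-comm 1 q)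
                     (m<1+n⇒m≤n (subst (_≤ suc n) j≡2+q (RunStart-≤ {n} {σ} start))))

MinRunStart-elim : ∀ {n σ q} → MinRunStart n σ (suc (suc q)) → 1 ≤ q → σ q ≡ suc q → σ (suc q) ≢ q
MinRunStart-elim {n} {σ} {q} ((_ , (r , 2+q+2r≡1+n) , run) , minimal) 1≤q σq≡1+q σ[1+q]≡q =
  1+n≰n (≤-trans (n≤1+n (suc q)) (minimal q (1≤q , (suc r , trans (+-2*-suc q r) 2+q+2r≡1+n) , run′)))
  where
  run′ : TrailRun n σ q
  run′ zero _ rewrite +-identityʳ q | +-comm q 1 = σq≡1+q , σ[1+q]≡q
  run′ (suc i) bound rewrite +-2*-suc q i = run i bound

MinRunStart-≥2 : ∀ {n σ j} → ¬ Agree n σ (pi n) → MinRunStart n σ j → 2 ≤ j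
MinRunStart-≥2 {j = zero}          _  ((() , _) , _)
MinRunStart-≥2 {j = suc zero}      ¬π (start , _) = contradiction (RunStart-1⇒pi start) ¬π
MinRunStart-≥2 {j = suc (suc _)}   _  _           = s≤s (s≤s z≤n)

RunStart-peel : ∀ {k σ j} → RunStart (suc (suc k)) σ j →
  j ≡ suc (suc (suc k)) ⊎ (RunStart k σ j × σ (suc k) ≡ suc (suc k) × σ (suc (suc k)) ≡ suc k)
RunStart-peel {j = j} (_ , (zero , j+0≡3+k) , _) = inj₁ (trans (sym (+-identityʳ j)) j+0≡3+k)
RunStart-peel {k} {σ} {j} (1≤j , (suc r , j+2[1+r]≡3+k) , run) =
  inj₂ ((1≤j , (r , j+2r≡1+k) , TrailRun-mono {σ = σ} {j = j} (m≤n⇒m≤1+n (n≤1+n k)) run) ,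
        last-pair)
  where
  j+2r≡1+k : j + 2 * r ≡ suc k
  j+2r≡1+k = suc-injective (suc-injective (trans (sym (+-2*-suc j r)) j+2[1+r]≡3+k))
  last-pair : σ (suc k) ≡ suc (suc k) × σ (suc (suc k)) ≡ suc k
  last-pair = subst (λ t → σ t ≡ suc t × σ (suc t) ≡ t) j+2r≡1+k
    (let σt , σ[t+1] = run r (subst (_≤ suc (suc k)) (sym (+-comm (j + 2 * r) 1))
                                     (s≤s (≤-reflexive j+2r≡1+k)))
     in trans σt (+-comm (j + 2 * r) 1) , trans (cong σ (+-comm 1 (j + 2 * r))) σ[t+1])

del-last-pair : ∀ {k σ} → IsPerm (suc (suc k)) σ → σ (suc k) ≡ suc (suc k) → σ (suc (suc k)) ≡ suc k →
  Agree k (del (suc (suc k)) σ) σ × del (suc (suc k)) σ (suc k) ≡ suc k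
del-last-pair {k} {σ} (_ , inj) σ[1+k]≡2+k σ[2+k]≡1+k =
  (λ x 1≤x x≤k → del-miss {suc (suc k)} {σ} {x}
     (λ σx≡2+k → <⇒≢ (s≤s x≤k) (inj x (suc k) 1≤x (m≤n⇒m≤1+n (m≤n⇒m≤1+n x≤k)) (s≤s z≤n) (n≤1+n _)
                                  (trans σx≡2+k (sym σ[1+k]≡2+k))))) ,
  trans (del-hit {suc (suc k)} {σ} {suc k} σ[1+k]≡2+k) σ[2+k]≡1+k

no-derangement-1 : ∀ {σ} → ¬ IsDer 1 σ
no-derangement-1 ((range , _) , fixfree) =
  fixfree 1 ≤-refl ≤-refl (≤-antisym (proj₂ (range 1 ≤-refl ≤-refl)) (proj₁ (range 1 ≤-refl ≤-refl)))

rule-i : ∀ {n σ τ} → IsDer n σ → σ (σ n) ≢ n →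
  τ n ≡ σ (σ n) → τ (σ n) ≡ σ n → (∀ x → 1 ≤ x → x < n → x ≢ σ n → τ x ≡ σ x) → Alpha n σ τ
rule-i {zero}        _   _ _ _ _ = a0
rule-i {suc zero}    der _ _ _ _ = contradiction der no-derangement-1
rule-i {suc (suc k)} {σ} {τ} der@((_ , inj) , fixfree) σσn≢n τn τa τx = ai der σσn≢n agree
  where
  n = suc (suc k)
  a = σ n
  a≢n : a ≢ n
  a≢n = fixfree n (s≤s z≤n) ≤-refl
  agree : Agree n τ (f n a (del n σ))
  agree x 1≤x x≤n with m≤n⇒m<n∨m≡n x≤n
  ... | inj₂ refl = trans τn (sym (trans (f-new {n} {a} {del n σ} a≢n) (del-miss {n} {σ} {a} σσn≢n)))
  ... | inj₁ x<n with x ≟ a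
  ...   | yes refl = trans τa (sym (f-fixed {n} {a} {del n σ} a≢n))
  ...   | no  x≢a with σ x ≟ n
  ...     | yes σx≡n = trans (τx x 1≤x x<n x≢a)
                         (trans σx≡n (sym (f-redirect {n} {a} {del n σ} {x} a≢n x≢a (<⇒≢ x<n)
                                            (del-hit {n} {σ} {x} σx≡n))))
  ...     | no  σx≢n = trans (τx x 1≤x x<n x≢a)
                         (sym (trans (f-keep {n} {a} {del n σ} {x} a≢n x≢a (<⇒≢ x<n) ρx≢a)
                                (del-miss {n} {σ} {x} σx≢n)))
    where
    ρx≢a : del n σ x ≢ a
    ρx≢a ρx≡a = <⇒≢ x<n (inj x n 1≤x x≤n (s≤s z≤n) ≤-refl (trans (sym (del-miss {n} {σ} {x} σx≢n)) ρx≡a))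

rule-ii : ∀ {m σ τ} → IsDer (suc m) σ → σ (σ (suc m)) ≡ suc m →
  IsDer m τ → Alpha m τ (del (suc m) σ) → τ (suc m) ≡ suc m → Alpha (suc m) σ τ
rule-ii {zero}  der _ _ _ _ = contradiction der no-derangement-1
rule-ii {suc k} {σ} {τ} der σσn≡n derτ α τn≡n = aii-D τ der σσn≡n α derτ agree
  where
  agree : Agree (suc (suc k)) τ (f (suc (suc k)) (suc (suc k)) τ)
  agree x _ _ with x ≟ suc (suc k)
  ... | yes refl = trans τn≡n (sym (f-top {suc (suc k)} {τ}))
  ... | no  x≢n  = sym (f-below {suc (suc k)} {τ} {x} x≢n)

case1-low-IsDer : ∀ {n q σ τ} → IsDer n σ → suc q ≤ n → (∀ x → 1 ≤ x → x ≤ suc q → σ x ≤ suc q) →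
  σ (σ (suc q)) ≡ suc q → σ (suc q) < q →
  τ q ≡ σ (suc q) → τ (σ (suc q)) ≡ σ q → (∀ x → 1 ≤ x → x < q → x ≢ σ (suc q) → τ x ≡ σ x) →
  IsDer q τ
case1-low-IsDer {n} {q} {σ} {τ} (perm , fixfree) p≤n closed σa≡p a<q τq≡a τa≡b τx≡σx =
  IsPerm-cong agree
    (IsPerm-del (IsPerm-∘ (IsPerm-restrict p≤n closed perm) (IsPerm-swap 1≤q (n≤1+n q) (s≤s z≤n) ≤-refl))) ,
  fixfree′
  where
  open ≡-Reasoning
  p = suc q
  a = σ p
  inj = proj₂ perm
  1≤a : 1 ≤ a
  1≤a = proj₁ (proj₁ perm p (s≤s z≤n) p≤n)
  1≤q = ≤-trans 1≤a (<⇒≤ a<q)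
  ≤n : ∀ {x} → x ≤ q → x ≤ n
  ≤n x≤q = ≤-trans (m≤n⇒m≤1+n x≤q) p≤n
  a≢p : a ≢ p
  a≢p = <⇒≢ (m<n⇒m<1+n a<q)
  g = σ ∘ swap q p
  agree : Agree q (del p g) τ
  agree x 1≤x x≤q with x ≟ q
  ... | yes refl = begin
    del p g q ≡⟨ del-miss {p} {g} {q} (λ gq≡p → a≢p (trans (sym gq≡a) gq≡p)) ⟩
    g q       ≡⟨ gq≡a ⟩
    a         ≡⟨ τq≡a ⟨
    τ q       ∎
    where gq≡a = cong σ (swap-left {q} {p})
  ... | no x≢q with x ≟ a
  ...   | yes refl = begin
    del p g a     ≡⟨ del-hit {p} {g} {a} (trans (cong σ (swap-other {q} {p} x≢q a≢p)) σa≡p) ⟩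
    σ (swap q p p) ≡⟨ cong σ (swap-right {q} {p}) ⟩
    σ q           ≡⟨ τa≡b ⟨
    τ a           ∎
  ...   | no x≢a = begin
    del p g x ≡⟨ del-miss {p} {g} {x} (λ gx≡p → x≢a (σx≡σa⇒x≡a (trans (sym gx≡σx) (trans gx≡p (sym σa≡p))))) ⟩
    g x       ≡⟨ gx≡σx ⟩
    σ x       ≡⟨ τx≡σx x 1≤x (≤∧≢⇒< x≤q x≢q) x≢a ⟨
    τ x       ∎
    where
    gx≡σx = cong σ (swap-other {q} {p} x≢q (<⇒≢ (s≤s x≤q)))
    σx≡σa⇒x≡a : σ x ≡ σ a → x ≡ a
    σx≡σa⇒x≡a = inj x a 1≤x (≤n x≤q) 1≤a (≤n (<⇒≤ a<q))
  fixfree′ : ∀ x → 1 ≤ x → x ≤ q → τ x ≢ x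
  fixfree′ x 1≤x x≤q with x ≟ q
  ... | yes refl = λ τq≡q → <⇒≢ a<q (trans (sym τq≡a) τq≡q)
  ... | no x≢q with x ≟ a
  ...   | yes refl = λ τa≡a → <⇒≢ (n<1+n q)
                       (inj q p 1≤q (≤n ≤-refl) (s≤s z≤n) p≤n (trans (sym τa≡b) τa≡a))
  ...   | no x≢a rewrite τx≡σx x 1≤x (≤∧≢⇒< x≤q x≢q) x≢a = fixfree x 1≤x (≤n x≤q)

case2-low-IsDer : ∀ {n p σ τ} → IsDer n σ → suc p ≤ n → (∀ x → 1 ≤ x → x ≤ p → σ x ≤ p) → 1 ≤ p →
  σ (σ p) ≢ p → τ p ≡ σ (σ p) → τ (suc p) ≡ σ p → τ (σ p) ≡ suc p →
  (∀ x → 1 ≤ x → x < suc p → x ≢ p → x ≢ σ p → τ x ≡ σ x) →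
  IsDer (suc p) τ
case2-low-IsDer {n} {p} {σ} {τ} (perm , fixfree) j≤n closed 1≤p σa≢p τp≡b τj≡a τa≡j τx≡σx =
  IsPerm-cong agree (IsPerm-∘ (IsPerm-∘ (IsPerm-extend (IsPerm-restrict p≤n closed perm))
                                        (IsPerm-swap 1≤p (n≤1+n p) 1≤a a≤j))
                              (IsPerm-swap 1≤a a≤j (s≤s z≤n) ≤-refl)) ,
  fixfree′
  where
  open ≡-Reasoning
  j = suc p
  a = σ p
  p≤n = ≤-trans (n≤1+n p) j≤n
  1≤a : 1 ≤ a
  1≤a = proj₁ (proj₁ perm p 1≤p p≤n)
  a<p : a < p
  a<p = ≤∧≢⇒< (closed p 1≤p ≤-refl) (fixfree p 1≤p p≤n)
  a≤j = ≤-trans (<⇒≤ a<p) (n≤1+n p)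
  a≢j = <⇒≢ (m<n⇒m<1+n a<p)
  -- on [j], τ is σ with the fixed point j appended, composed with the 3-cycle (p a j)
  σ⁺ = f j j σ
  g = σ⁺ ∘ swap p a ∘ swap a j
  agree : Agree j g τ
  agree x 1≤x x≤j with ≤-suc-split x≤j
  ... | inj₂ refl = begin
    σ⁺ (swap p a (swap a j j)) ≡⟨ cong (σ⁺ ∘ swap p a) (swap-right {a} {j}) ⟩
    σ⁺ (swap p a a)            ≡⟨ cong σ⁺ (swap-right {p} {a}) ⟩
    σ⁺ p                       ≡⟨ f-below {j} {σ} {p} (<⇒≢ (n<1+n p)) ⟩
    a                          ≡⟨ τj≡a ⟨
    τ j                        ∎
  ... | inj₁ x≤p with x ≟ p
  ...   | yes refl = begin
    σ⁺ (swap p a (swap a j p)) ≡⟨ cong (σ⁺ ∘ swap p a) (swap-other {a} {j} (>⇒≢ a<p) (<⇒≢ (n<1+n p))) ⟩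
    σ⁺ (swap p a p)            ≡⟨ cong σ⁺ (swap-left {p} {a}) ⟩
    σ⁺ a                       ≡⟨ f-below {j} {σ} {a} a≢j ⟩
    σ a                        ≡⟨ τp≡b ⟨
    τ p                        ∎
  ...   | no x≢p with x ≟ a
  ...     | yes refl = begin
    σ⁺ (swap p a (swap a j a)) ≡⟨ cong (σ⁺ ∘ swap p a) (swap-left {a} {j}) ⟩
    σ⁺ (swap p a j)            ≡⟨ cong σ⁺ (swap-other {p} {a} (>⇒≢ (n<1+n p)) (>⇒≢ (m<n⇒m<1+n a<p))) ⟩
    σ⁺ j                       ≡⟨ f-top {j} {σ} ⟩
    j                          ≡⟨ τa≡j ⟨
    τ a                        ∎
  ...     | no x≢a = begin
    σ⁺ (swap p a (swap a j x)) ≡⟨ cong (σ⁺ ∘ swap p a) (swap-other {a} {j} x≢a x≢j) ⟩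
    σ⁺ (swap p a x)            ≡⟨ cong σ⁺ (swap-other {p} {a} x≢p x≢a) ⟩
    σ⁺ x                       ≡⟨ f-below {j} {σ} {x} x≢j ⟩
    σ x                        ≡⟨ τx≡σx x 1≤x (s≤s x≤p) x≢p x≢a ⟨
    τ x                        ∎
    where x≢j = <⇒≢ (s≤s x≤p)
  fixfree′ : ∀ x → 1 ≤ x → x ≤ j → τ x ≢ x
  fixfree′ x 1≤x x≤j with ≤-suc-split x≤j
  ... | inj₂ refl = λ τj≡j → a≢j (trans (sym τj≡a) τj≡j)
  ... | inj₁ x≤p with x ≟ p
  ...   | yes refl = λ τp≡p → σa≢p (trans (sym τp≡b) τp≡p)
  ...   | no x≢p with x ≟ a
  ...     | yes refl = λ τa≡a → a≢j (sym (trans (sym τa≡j) τa≡a))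
  ...     | no x≢a rewrite τx≡σx x 1≤x (s≤s x≤p) x≢p x≢a = fixfree x 1≤x (≤-trans x≤p p≤n)

PairsBelow : ℕ → (ℕ → ℕ) → ℕ → Set
PairsBelow n τ s = ∀ i → s + 2 * i + 2 ≤ n →
  (τ (s + 2 * i) ≡ s + 2 * i + 1) × (τ (s + 2 * i + 1) ≡ s + 2 * i)

PairsBelow⇒TrailRun : ∀ {m τ s} → PairsBelow (suc m) τ s → TrailRun m τ s
PairsBelow⇒TrailRun {m} {s = s} pairs i top≤m =
  pairs i (subst (_≤ suc m) (sym (+-suc (s + 2 * i) 1)) (s≤s top≤m))

TrailRun⇒PairsBelow : ∀ {m τ s} → TrailRun m τ s → PairsBelow (suc m) τ s
TrailRun⇒PairsBelow {m} {s = s} run i bound =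
  run i (≤-pred (subst (_≤ suc m) (+-suc (s + 2 * i) 1) bound))

TrailRun-cong : ∀ {m σ σ′ j} → 1 ≤ j → Agree m σ σ′ → TrailRun m σ j → TrailRun m σ′ j
TrailRun-cong {m} {σ} {σ′} {j} 1≤j σ≈σ′ run i top≤m =
  trans (sym (σ≈σ′ (j + 2 * i) 1≤j+2i (≤-trans (m≤m+n _ 1) top≤m))) (proj₁ (run i top≤m)) ,
  trans (sym (σ≈σ′ (j + 2 * i + 1) (≤-trans 1≤j+2i (m≤m+n _ 1)) top≤m)) (proj₂ (run i top≤m))
  where 1≤j+2i = ≤-trans 1≤j (m≤m+n j (2 * i))

del-last-pair-run : ∀ {k σ j} → IsPerm (suc (suc k)) σ → RunStart k σ j →
  σ (suc k) ≡ suc (suc k) → σ (suc (suc k)) ≡ suc k → PairsBelow (suc k) (del (suc (suc k)) σ) j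
del-last-pair-run {k} {σ} {j} perm (1≤j , _ , run) σ[1+k]≡2+k σ[2+k]≡1+k =
  TrailRun⇒PairsBelow {k} {del (suc (suc k)) σ} {j}
    (TrailRun-cong {k} {σ} {j = j} 1≤j (λ x 1≤x x≤k → sym (del≈σ x 1≤x x≤k)) run)
  where del≈σ = proj₁ (del-last-pair perm σ[1+k]≡2+k σ[2+k]≡1+k)

-- j is written q+2 resp. p+1 so that j ∸ 1 and j ∸ 2 reduce.
Case1Formula : ℕ → Set
Case1Formula n = ∀ σ q → IsDer n σ → MinRunStart n σ (suc (suc q)) →
  σ (σ (suc q)) ≡ suc q → ∀ τ → Case1 n σ (suc (suc q)) τ → Alpha n σ τ

Case2Formula : ℕ → Set
Case2Formula n = ∀ σ p → IsDer n σ → MinRunStart n σ (suc p) → 1 ≤ p →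
  σ (σ p) ≢ p → ∀ τ → Case2 n σ (suc p) τ → Alpha n σ τ

module Case1Facts {n q σ τ} (der : IsDer n σ) (min : MinRunStart n σ (suc (suc q)))
                  (σσp≡p : σ (σ (suc q)) ≡ suc q) (spec : Case1 n σ (suc (suc q)) τ) where
  p = suc q
  a = σ p
  range = proj₁ (proj₁ der)
  inj = proj₂ (proj₁ der)
  fixfree = proj₂ der
  p≤n : p ≤ n
  p≤n = m<1+n⇒m≤n (RunStart-≤ {n} {σ} (proj₁ min))
  closed : ∀ x → 1 ≤ x → x ≤ p → σ x ≤ p
  closed = run-closed-below (proj₁ der) (proj₁ min)
  1≤a : 1 ≤ a
  1≤a = proj₁ (range p (s≤s z≤n) p≤n)
  a≤q : a ≤ q
  a≤q = m<1+n⇒m≤n (≤∧≢⇒< (closed p (s≤s z≤n) ≤-refl) (fixfree p (s≤s z≤n) p≤n))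
  a<q : a < q
  a<q = ≤∧≢⇒< a≤q (λ a≡q → MinRunStart-elim {n} {σ} min (subst (1 ≤_) a≡q 1≤a)
                              (subst (λ t → σ t ≡ p) a≡q σσp≡p) a≡q)
  1≤q : 1 ≤ q
  1≤q = ≤-trans 1≤a (<⇒≤ a<q)
  q≤n : q ≤ n
  q≤n = ≤-trans (n≤1+n q) p≤n
  b≢q : σ q ≢ q
  b≢q = fixfree q 1≤q q≤n
  τq≡a : τ q ≡ a
  τq≡a = proj₁ spec
  τa≡b : τ a ≡ σ q
  τa≡b = proj₁ (proj₂ spec)
  τ≡σ-below : ∀ x → 1 ≤ x → x < q → x ≢ a → τ x ≡ σ x
  τ≡σ-below x 1≤x x<q = proj₁ (proj₂ (proj₂ spec)) x 1≤x (m<n⇒m<1+n x<q) (<⇒≢ x<q)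
  τ-low-IsDer : IsDer q τ
  τ-low-IsDer = case1-low-IsDer der p≤n closed σσp≡p a<q τq≡a τa≡b τ≡σ-below
  ττq≢q : τ (τ q) ≢ q
  ττq≢q ττq≡q = b≢q (trans (sym τa≡b) (trans (cong τ (sym τq≡a)) ττq≡q))

case1-at-end : ∀ {k σ τ} → IsDer (suc (suc k)) σ → MinRunStart (suc (suc k)) σ (suc (suc (suc k))) →
  σ (σ (suc (suc k))) ≡ suc (suc k) → Case1 (suc (suc k)) σ (suc (suc (suc k))) τ → Alpha (suc (suc k)) σ τ
case1-at-end {k} {σ} {τ} der min σσn≡n spec =
  rule-ii der σσn≡n τ-low-IsDer α (proj₂ (proj₂ (proj₂ (proj₂ spec))))
  where
  open Case1Facts der min σσn≡n spec
  n = suc (suc k)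
  a≤n = ≤-trans (<⇒≤ a<q) q≤n
  σx≢n : ∀ {x} → 1 ≤ x → x ≤ n → x ≢ a → σ x ≢ n
  σx≢n {x} 1≤x x≤n x≢a σx≡n = x≢a (inj x a 1≤x x≤n 1≤a a≤n (trans σx≡n (sym σσn≡n)))
  α : Alpha (suc k) τ (del n σ)
  α = rule-i τ-low-IsDer ττq≢q
        (trans (del-miss {n} {σ} {suc k} (σx≢n 1≤q q≤n (>⇒≢ a<q))) (sym (trans (cong τ τq≡a) τa≡b)))
        (trans (cong (del n σ) τq≡a) (trans (del-hit {n} {σ} {a} σσn≡n) (sym τq≡a)))
        (λ x 1≤x x<q x≢τq → let x≢a = λ x≡a → x≢τq (trans x≡a (sym τq≡a)) in
           trans (del-miss {n} {σ} {x} (σx≢n 1≤x (≤-trans (<⇒≤ x<q) q≤n) x≢a))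
                 (sym (τ≡σ-below x 1≤x x<q x≢a)))

case1-trailing : ∀ {k σ q τ} → Case2Formula (suc k) →
  IsDer (suc (suc k)) σ → MinRunStart (suc (suc k)) σ (suc (suc q)) →
  RunStart k σ (suc (suc q)) → σ (suc k) ≡ suc (suc k) → σ (suc (suc k)) ≡ suc k →
  σ (σ (suc q)) ≡ suc q → Case1 (suc (suc k)) σ (suc (suc q)) τ → Alpha (suc (suc k)) σ τ
case1-trailing {k} {σ} {q} {τ} case2 der min start@(_ , (r , j+2r≡1+k) , _) σ[1+k]≡n σn≡1+k σσp≡p spec =
  rule-ii der (trans (cong σ σn≡1+k) σ[1+k]≡n) τ-IsDer
    (case2 τ q τ-IsDer τ-min 1≤q ττq≢q (del n σ) spec′) (proj₂ (proj₂ (proj₂ (proj₂ spec))))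
  where
  open Case1Facts der min σσp≡p spec
  n = suc (suc k)
  del≈σ : Agree k (del n σ) σ
  del≈σ = proj₁ (del-last-pair (proj₁ der) σ[1+k]≡n σn≡1+k)
  p≤k : p ≤ k
  p≤k = m<1+n⇒m≤n (RunStart-≤ {k} {σ} start)
  q≤k = ≤-trans (n≤1+n q) p≤k
  a≤k = ≤-trans (<⇒≤ a<q) q≤k
  q+2[1+r]≡1+k : q + 2 * suc r ≡ suc k
  q+2[1+r]≡1+k = trans (+-2*-suc q r) j+2r≡1+k
  τ-run : TrailRun (suc k) τ (suc q)
  τ-run = PairsBelow⇒TrailRun {suc k} {τ} {suc q} (proj₁ (proj₂ (proj₂ (proj₂ spec))))
  τ-IsDer : IsDer (suc k) τ
  τ-IsDer = IsDer-extend-run (suc r) τ-low-IsDer τ-run q+2[1+r]≡1+k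
  no-pair : ∀ q′ → suc q ≡ suc (suc q′) → 1 ≤ q′ → τ q′ ≡ suc q′ → τ (suc q′) ≢ q′
  no-pair q′ 1+q≡2+q′ _ τq′≡1+q′ τ[1+q′]≡q′ =
    b≢q (trans (sym τa≡b) (trans (cong τ a≡q′) (trans τq′≡1+q′ (sym q≡1+q′))))
    where
    q≡1+q′ = suc-injective 1+q≡2+q′
    a≡q′ = trans (sym τq≡a) (trans (cong τ q≡1+q′) τ[1+q′]≡q′)
  τ-min : MinRunStart (suc k) τ (suc q)
  τ-min = MinRunStart-intro (s≤s z≤n , (suc r , cong suc q+2[1+r]≡1+k) , τ-run) no-pair
  spec′ : Case2 (suc k) τ (suc q) (del n σ)
  spec′ =
    trans (del≈σ q 1≤q q≤k) (sym (trans (cong τ τq≡a) τa≡b)) ,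
    (λ x 1≤x x<1+q x≢q x≢τq →
      trans (del≈σ x 1≤x (≤-trans (m<1+n⇒m≤n x<1+q) q≤k))
        (sym (τ≡σ-below x 1≤x (≤∧≢⇒< (m<1+n⇒m≤n x<1+q) x≢q)
                (λ x≡a → x≢τq (trans x≡a (sym τq≡a)))))) ,
    (λ 1+q≡2+k → contradiction (subst (_≤ k) (suc-injective 1+q≡2+k) q≤k) 1+n≰n) ,
    (λ _ → trans (del≈σ p (s≤s z≤n) p≤k) (sym τq≡a) ,
           trans (cong (del n σ) τq≡a) (trans (del≈σ a 1≤a a≤k) σσp≡p) ,
           subst (PairsBelow (suc k) (del n σ)) (+-comm 1 (suc q))
             (del-last-pair-run (proj₁ der) start σ[1+k]≡n σn≡1+k) ,
           proj₂ (del-last-pair (proj₁ der) σ[1+k]≡n σn≡1+k))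

case2-at-end : ∀ {n σ τ} → IsDer n σ → σ (σ n) ≢ n → Case2 n σ (suc n) τ → Alpha n σ τ
case2-at-end der σσn≢n (τn≡b , τ≡σ-below , τa≡a , _) =
  rule-i der σσn≢n τn≡b (τa≡a refl) (λ x 1≤x x<n → τ≡σ-below x 1≤x (m<n⇒m<1+n x<n) (<⇒≢ x<n))

case2-trailing : ∀ {k σ p τ} → Case1Formula (suc k) →
  IsDer (suc (suc k)) σ → MinRunStart (suc (suc k)) σ (suc p) → 1 ≤ p →
  RunStart k σ (suc p) → σ (suc k) ≡ suc (suc k) → σ (suc (suc k)) ≡ suc k →
  σ (σ p) ≢ p → Case2 (suc (suc k)) σ (suc p) τ → Alpha (suc (suc k)) σ τ
case2-trailing {k} {σ} {p} {τ} case1 der min 1≤p start@(_ , (r , j+2r≡1+k) , _) σ[1+k]≡n σn≡1+k σa≢p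
               (τp≡b , τ≡σ-below , _ , τ-rest) =
  rule-ii der (trans (cong σ σn≡1+k) σ[1+k]≡n) τ-IsDer
    (case1 τ p τ-IsDer τ-min (trans (cong τ τj≡a) τa≡j) (del n σ) spec′) τn≡n
  where
  n = suc (suc k)
  j = suc p
  a = σ p
  del≈σ : Agree k (del n σ) σ
  del≈σ = proj₁ (del-last-pair (proj₁ der) σ[1+k]≡n σn≡1+k)
  j≤1+k : j ≤ suc k
  j≤1+k = RunStart-≤ {k} {σ} start
  p≤k = ≤-pred j≤1+k
  p≤n = ≤-trans p≤k (m≤n⇒m≤1+n (n≤1+n k))
  closed : ∀ x → 1 ≤ x → x ≤ p → σ x ≤ p
  closed = run-closed-below (proj₁ der) (proj₁ min)
  1≤a : 1 ≤ a
  1≤a = proj₁ (proj₁ (proj₁ der) p 1≤p p≤n)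
  a≤k = ≤-trans (closed p 1≤p ≤-refl) p≤k
  τ-facts = τ-rest (subst (_≤ n) (+-comm 1 j) (s≤s j≤1+k))
  τj≡a : τ j ≡ a
  τj≡a = proj₁ τ-facts
  τa≡j : τ a ≡ j
  τa≡j = proj₁ (proj₂ τ-facts)
  τn≡n : τ n ≡ n
  τn≡n = proj₂ (proj₂ (proj₂ τ-facts))
  τ-run : TrailRun (suc k) τ (suc j)
  τ-run = PairsBelow⇒TrailRun {suc k} {τ} {suc j}
            (subst (PairsBelow n τ) (+-comm j 1) (proj₁ (proj₂ (proj₂ τ-facts))))
  τ-IsDer : IsDer (suc k) τ
  τ-IsDer = IsDer-extend-run r
    (case2-low-IsDer der (m≤n⇒m≤1+n j≤1+k) closed 1≤p σa≢p τp≡b τj≡a τa≡j τ≡σ-below) τ-run j+2r≡1+k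
  no-pair : ∀ q′ → suc j ≡ suc (suc q′) → 1 ≤ q′ → τ q′ ≡ suc q′ → τ (suc q′) ≢ q′
  no-pair q′ 1+j≡2+q′ _ _ τ[1+q′]≡q′ =
    proj₂ der p 1≤p p≤n (trans (sym τj≡a) (trans (cong τ j≡1+q′) (trans τ[1+q′]≡q′ (sym p≡q′))))
    where
    j≡1+q′ = suc-injective 1+j≡2+q′
    p≡q′ = suc-injective j≡1+q′
  τ-min : MinRunStart (suc k) τ (suc j)
  τ-min = MinRunStart-intro (s≤s z≤n , (r , cong suc j+2r≡1+k) , τ-run) no-pair
  spec′ : Case1 (suc k) τ (suc j) (del n σ)
  spec′ =
    trans (del≈σ p 1≤p p≤k) (sym τj≡a) ,
    trans (cong (del n σ) τj≡a) (trans (del≈σ a 1≤a a≤k) (sym τp≡b)) ,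
    (λ x 1≤x x<j x≢p x≢τj →
      trans (del≈σ x 1≤x (≤-trans (m<1+n⇒m≤n x<j) p≤k))
        (sym (τ≡σ-below x 1≤x x<j x≢p (λ x≡a → x≢τj (trans x≡a (sym τj≡a)))))) ,
    del-last-pair-run (proj₁ der) start σ[1+k]≡n σn≡1+k ,
    proj₂ (del-last-pair (proj₁ der) σ[1+k]≡n σn≡1+k)

case1-formula : ∀ {k} → Case2Formula (suc k) → Case1Formula (suc (suc k))
case1-formula {k} case2 σ q der min σσp≡p τ spec with RunStart-peel {k} {σ} (proj₁ min)
... | inj₁ refl = case1-at-end der min σσp≡p spec
... | inj₂ (start , σ[1+k]≡n , σn≡1+k) =
  case1-trailing case2 der min start σ[1+k]≡n σn≡1+k σσp≡p spec

case2-formula : ∀ {k} → Case1Formula (suc k) → Case2Formula (suc (suc k))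
case2-formula {k} case1 σ p der min 1≤p σσp≢p τ spec with RunStart-peel {k} {σ} (proj₁ min)
... | inj₁ refl = case2-at-end der σσp≢p spec
... | inj₂ (start , σ[1+k]≡n , σn≡1+k) =
  case2-trailing case1 der min 1≤p start σ[1+k]≡n σn≡1+k σσp≢p spec

case-formulas : ∀ n → Case1Formula n × Case2Formula n
case-formulas zero          = (λ _ _ _ _ _ _ _ → a0) , (λ _ _ _ _ _ _ _ _ → a0)
case-formulas (suc zero)    = (λ _ _ der _ _ _ _ → contradiction der no-derangement-1) ,
                              (λ _ _ der _ _ _ _ _ → contradiction der no-derangement-1)
case-formulas (suc (suc k)) =
  let case1 , case2 = case-formulas (suc k) in case1-formula case2 , case2-formula case1

alpha-on-derangements : ∀ {n σ j} → IsDer n σ → MinRunStart n σ j → 2 ≤ j →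
  (σ (σ (j ∸ 1)) ≡ j ∸ 1 → ∀ τ → Case1 n σ j τ → Alpha n σ τ) ×
  (σ (σ (j ∸ 1)) ≢ j ∸ 1 → ∀ τ → Case2 n σ j τ → Alpha n σ τ)
alpha-on-derangements {j = zero}        _   _   ()
alpha-on-derangements {j = suc zero}    _   _   (s≤s ())
alpha-on-derangements {n} {σ} {suc (suc q)} der min _ =
  proj₁ (case-formulas n) σ q der min , proj₂ (case-formulas n) σ (suc q) der min (s≤s z≤n)

theorem1 : ∀ (n : ℕ) → 1 ≤ n →
    Alpha n (pi n) (pi n) ×
    (∀ (σ : ℕ → ℕ) → IsDer n σ → ¬ Agree n σ (pi n) →
      ∀ (j : ℕ) → MinRunStart n σ j →
        (2 ≤ j) ×
        (σ (σ (j ∸ 1)) ≡ j ∸ 1 → ∀ (τ : ℕ → ℕ) → Case1 n σ j τ → Alpha n σ τ) ×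
        (σ (σ (j ∸ 1)) ≢ j ∸ 1 → ∀ (τ : ℕ → ℕ) → Case2 n σ j τ → Alpha n σ τ))
theorem1 n 1≤n =
  pi-fixed n 1≤n ,
  λ σ der σ≉π j min → let 2≤j = MinRunStart-≥2 σ≉π min in 2≤j , alpha-on-derangements der min 2≤j
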